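{- Let $(\bar{A},\bar{B})$ be an upper-triangular pair in a matroid $M$, with $\bar A=(a_1,\dots,a_n)$, $\bar B=(b_1,\dots,b_n)$, and let $\varphi\colon E(M) \to E(M)$ be the associated involution. Let $X \subseteq \{a_1,\dots,a_n\}$ and $Y = \varphi(X)$. Then $(\bar{A}-X, \bar{B}-Y)$ is upper-triangular in both $M/X \setminus Y$ and $M/Y \setminus X$.
   Context: For $n$-tuples $\bar A=(a_1,\dots,a_n)$ and $\bar B=(b_1,\dots,b_n)$ of distinct elements of a matroid $M$, the pair $(\bar A,\bar B)$ is upper-triangular in $M$ if $(\{a_1,\dots,a_n\},\{b_1,\dots,b_n\})$ is a partition of $E(M)$ into two bases and $\mathrm{cl}_M(\{a_1,\dots,a_k\}) = \mathrm{cl}_M(\{b_1,\dots,b_k\})$ for every $k \in \{1,\dots,n\}$. The associated involution $\varphi$ is defined by $\varphi(a_i)=b_i$ and $\varphi(b_i)=a_i$. For a set $X$, $\bar A - X$ denotes the tuple obtained from $\bar A$ by removing the entries in $X$ while keeping the order of the others (similarly $\bar B - Y$). -}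

module Defs where

open import Data.Nat using (ℕ; _<_; _≤_)
open import Data.Fin using (Fin)
open import Data.Fin.Subset
  using (Subset; _∈_; _∉_; _⊆_; _∪_; _∩_; _─_; ∣_∣; ⁅_⁆)
  renaming (⊥ to ∅)
open import Data.List using (List; []; _∷_; length; take; filter; map; zip)
open import Data.Fin.Subset.Properties using (_∈?_)
open import Data.List.Relation.Unary.Unique.Propositional using (Unique)
open import Data.Product using (Σ; ∃; _×_; proj₁; proj₂)
open import Relation.Nullary using (¬_)
open import Relation.Nullary.Decidable using (¬?)
open import Relation.Binary.PropositionalEquality using (_≡_)

record SetSystem (m : ℕ) : Set₁ where
  field
    ground : Subset m
    Indep  : Subset m → Set

record Matroid (m : ℕ) : Set₁ where
  field
    ground      : Subset m
    Indep       : Subset m → Set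
    indep⊆      : ∀ {I} → Indep I → I ⊆ ground
    indep-∅     : Indep ∅
    indep-down  : ∀ {I J} → Indep J → I ⊆ J → Indep I
    indep-aug   : ∀ {I J} → Indep I → Indep J → ∣ I ∣ < ∣ J ∣ →
                  ∃ λ e → e ∈ J × e ∉ I × Indep (⁅ e ⁆ ∪ I)

  system : SetSystem m
  system = record { ground = ground ; Indep = Indep }

module _ {m : ℕ} (S : SetSystem m) where
  open SetSystem S

  HasRank : Subset m → ℕ → Set
  HasRank X k =
    (∃ λ I → I ⊆ X × Indep I × ∣ I ∣ ≡ k) ×
    (∀ J → J ⊆ X → Indep J → ∣ J ∣ ≤ k)

  InCl : Subset m → Fin m → Set
  InCl X e = e ∈ ground × ∃ λ k → HasRank X k × HasRank (X ∪ ⁅ e ⁆) k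

  SameCl : Subset m → Subset m → Set
  SameCl X Y = ∀ e → (InCl X e → InCl Y e) × (InCl Y e → InCl X e)

  IsBasis : Subset m → Set
  IsBasis B = B ⊆ ground × Indep B ×
              (∀ e → e ∈ ground → e ∉ B → ¬ Indep (⁅ e ⁆ ∪ B))

delete : ∀ {m} → SetSystem m → Subset m → SetSystem m
delete S D = record
  { ground = SetSystem.ground S ─ D
  ; Indep  = λ I → SetSystem.Indep S I × I ⊆ SetSystem.ground S ─ D }

contract : ∀ {m} → Matroid m → Subset m → SetSystem m
contract M C = record
  { ground = ground ─ C
  ; Indep  = λ I → I ⊆ ground ─ C ×
                   ∃ λ J → J ⊆ C × Indep J ×
                     (∀ e → e ∈ C → e ∉ J → ¬ Indep (⁅ e ⁆ ∪ J)) ×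
                     Indep (I ∪ J) }
  where open Matroid M

toSet : ∀ {m} → List (Fin m) → Subset m
toSet []       = ∅
toSet (x ∷ xs) = ⁅ x ⁆ ∪ toSet xs

UpperTriangular : ∀ {m} → SetSystem m → List (Fin m) → List (Fin m) → Set
UpperTriangular S as bs =
  length as ≡ length bs × Unique as × Unique bs ×
  toSet as ∩ toSet bs ≡ ∅ × toSet as ∪ toSet bs ≡ SetSystem.ground S ×
  IsBasis S (toSet as) × IsBasis S (toSet bs) ×
  (∀ k → 1 ≤ k → k ≤ length as →
     SameCl S (toSet (take k as)) (toSet (take k bs)))

-- φ(X) for the involution φ(aᵢ) = bᵢ, φ(bᵢ) = aᵢ, where X ⊆ {a₁,…,aₙ}
φImage : ∀ {m} → List (Fin m) → List (Fin m) → Subset m → Subset m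
φImage as bs X =
  toSet (map proj₂ (filter (λ p → proj₁ p ∈? X) (zip as bs)))

removeT : ∀ {m} → List (Fin m) → Subset m → List (Fin m)
removeT as X = filter (λ a → ¬? (a ∈? X)) as

module Submission where

-- We show that
-- (Ā − X, B̄ − Y) is upper-triangular in N = M / X \ Y; the statement for
-- M / Y \ X follows by exchanging the roles of Ā and B̄.
--
-- Closure is handled through spans: for an independent set I, e lies in
-- cl(I) iff e ∈ I or I + e is dependent.  Since X is independent, the span
-- of Z in N is the span of Z ∪ X in M, so everything reduces to M.
-- For a prefix length j let S_j = (A_j − X) ∪ X and T_j = (B_j − Y) ∪ X
-- (SA j and SB j below).
-- By induction on j we show that T_j is an independent set of the same size
-- as S_j lying in the span of S_j ("balanced"); hence cl(S_j) = cl(T_j),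
-- which in N reads cl_N(A_j − X) = cl_N(B_j − Y).  The induction step uses
-- cl(A_{j+1}) = cl(B_{j+1}) together with augmentation.

open import Defs
open import Data.Nat using (ℕ; zero; suc; _≤_; _<_; z≤n; s≤s; _≤?_; _+_)
open import Data.Nat.Properties
  using (≤-refl; ≤-trans; ≤-reflexive; <-≤-trans; n≤1+n; m≤n⇒m≤1+n; ≰⇒>; <⇒≤;
         n≮n; m<m+n; +-suc; +-identityʳ; m≤n⇒∃[o]m+o≡n; suc-injective;
         module ≤-Reasoning)
open import Data.Fin using (Fin; zero; suc; _≟_)
open import Data.Fin.Subset
  using (Subset; _∈_; _∉_; _⊆_; _∪_; _∩_; _─_; ∣_∣; ⁅_⁆; inside; outside)
  renaming (⊥ to ∅)
open import Data.Fin.Subset.Properties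
  using (_∈?_; x∈p∪q⁻; p⊆p∪q; q⊆p∪q; x∈⁅x⁆; x∈⁅y⁆⇒x≡y; ∉⊥; ⊥⊆; ⊆-antisym;
         p⊆q⇒∣p∣≤∣q∣; p⊂q⇒∣p∣<∣q∣; x∈p∩q⁺; x∈p∩q⁻; x∈p∧x∉q⇒x∈p─q; p─q⊆p;
         ∪-assoc; ∪-comm; ∪-identityˡ; ∩-comm)
open import Data.Vec.Base using (_∷_) renaming (here to hd; there to tl)
open import Data.List using (List; []; _∷_; _++_; length; take)
open import Data.List.Properties
  using (filter-accept; filter-reject; filter-++; take-all; ++-identityʳ)
open import Data.List.Membership.Propositional.Properties using (∈-++⁺ʳ)
open import Data.List.Relation.Unary.Any using (here)
open import Data.List.Relation.Unary.All using (All; []; _∷_)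
import Data.List.Relation.Unary.All as All
open import Data.List.Relation.Unary.AllPairs using (_∷_)
open import Data.List.Relation.Unary.Unique.Propositional using (Unique)
open import Data.List.Relation.Unary.Unique.Propositional.Properties
  using (filter⁺; take⁺)
open import Data.List.Relation.Binary.Pointwise
  using (Pointwise; []; _∷_; Pointwise-length; symmetric)
open import Data.Product using (∃; ∃₂; _×_; _,_; proj₁; proj₂; swap; map₁)
open import Data.Sum using (_⊎_; inj₁; inj₂; [_,_])
open import Data.Empty using (⊥-elim)
open import Function using (id)
open import Relation.Nullary using (¬_; yes; no)
open import Relation.Nullary.Decidable using (¬?)
open import Relation.Binary.PropositionalEquality
  using (_≡_; _≢_; refl; sym; trans; cong; subst; subst₂; module ≡-Reasoning)

∪-elim : ∀ {n} {p q : Subset n} {x} {C : Set} →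
         x ∈ p ∪ q → (x ∈ p → C) → (x ∈ q → C) → C
∪-elim {p = p} {q} x∈p∪q f g = [ f , g ] (x∈p∪q⁻ p q x∈p∪q)

∈∪ˡ : ∀ {n} {p : Subset n} (q : Subset n) {x} → x ∈ p → x ∈ p ∪ q
∈∪ˡ q = p⊆p∪q q

∈∪ʳ : ∀ {n} (p : Subset n) {q : Subset n} {x} → x ∈ q → x ∈ p ∪ q
∈∪ʳ p {q} = q⊆p∪q p q

∪-lub : ∀ {n} {p q r : Subset n} → p ⊆ r → q ⊆ r → p ∪ q ⊆ r
∪-lub p⊆r q⊆r x∈p∪q = ∪-elim x∈p∪q p⊆r q⊆r

∪-mono : ∀ {n} {p p′ q q′ : Subset n} → p ⊆ p′ → q ⊆ q′ → p ∪ q ⊆ p′ ∪ q′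
∪-mono {p′ = p′} {q′ = q′} p⊆p′ q⊆q′ =
  ∪-lub (λ x∈p → ∈∪ˡ q′ (p⊆p′ x∈p)) (λ x∈q → ∈∪ʳ p′ (q⊆q′ x∈q))

⁅⁆⊆ : ∀ {n} {x : Fin n} {p : Subset n} → x ∈ p → ⁅ x ⁆ ⊆ p
⁅⁆⊆ {x = x} x∈p y∈⁅x⁆ = subst (_∈ _) (sym (x∈⁅y⁆⇒x≡y x y∈⁅x⁆)) x∈p

∈─⇒∉ : ∀ {n} {p q : Subset n} {x} → x ∈ p ─ q → x ∉ q
∈─⇒∉ {p = _ ∷ p} {inside ∷ q} () hd
∈─⇒∉ {p = _ ∷ p} {outside ∷ q} hd ()
∈─⇒∉ {p = _ ∷ p} {_ ∷ q} (tl x∈p─q) (tl x∈q) = ∈─⇒∉ x∈p─q x∈q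

∣⁅x⁆∪p∣ : ∀ {n} {x : Fin n} {p : Subset n} → x ∉ p → ∣ ⁅ x ⁆ ∪ p ∣ ≡ suc ∣ p ∣
∣⁅x⁆∪p∣ {x = zero}  {inside ∷ p}  x∉p = ⊥-elim (x∉p hd)
∣⁅x⁆∪p∣ {x = zero}  {outside ∷ p} _   = cong (λ r → suc ∣ r ∣) (∪-identityˡ p)
∣⁅x⁆∪p∣ {x = suc x} {inside ∷ p}  x∉p = cong suc (∣⁅x⁆∪p∣ (λ x∈p → x∉p (tl x∈p)))
∣⁅x⁆∪p∣ {x = suc x} {outside ∷ p} x∉p = ∣⁅x⁆∪p∣ (λ x∈p → x∉p (tl x∈p))

∣p∪⁅x⁆∣≤ : ∀ {n} (p : Subset n) x → ∣ p ∪ ⁅ x ⁆ ∣ ≤ suc ∣ p ∣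
∣p∪⁅x⁆∣≤ p x with x ∈? p
... | yes x∈p = m≤n⇒m≤1+n (p⊆q⇒∣p∣≤∣q∣ (∪-lub id (⁅⁆⊆ x∈p)))
... | no  x∉p = ≤-reflexive (trans (cong ∣_∣ (∪-comm p ⁅ x ⁆)) (∣⁅x⁆∪p∣ x∉p))

⊆-by-card : ∀ {n} {p q : Subset n} → p ⊆ q → ∣ q ∣ ≤ ∣ p ∣ → q ⊆ p
⊆-by-card {p = p} p⊆q ∣q∣≤∣p∣ {x} x∈q with x ∈? p
... | yes x∈p = x∈p
... | no  x∉p = ⊥-elim (n≮n _ (<-≤-trans (p⊂q⇒∣p∣<∣q∣ (p⊆q , x , x∈q , x∉p)) ∣q∣≤∣p∣))

-- Closure versus span; this holds in any set system, no axioms needed.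

Spans : ∀ {m} → SetSystem m → Subset m → Fin m → Set
Spans S I e = e ∈ I ⊎ ¬ SetSystem.Indep S (⁅ e ⁆ ∪ I)

module Closure {m : ℕ} (S : SetSystem m) where
  open SetSystem S

  spanned-dependent : ∀ {K x} → Spans S K x → x ∉ K → ¬ Indep (⁅ x ⁆ ∪ K)
  spanned-dependent (inj₁ x∈K) x∉K _ = x∉K x∈K
  spanned-dependent (inj₂ dep) _     = dep

  rank≤size : ∀ {Z k} → HasRank S Z k → k ≤ ∣ Z ∣
  rank≤size ((I , I⊆Z , _ , ∣I∣≡k) , _) = ≤-trans (≤-reflexive (sym ∣I∣≡k)) (p⊆q⇒∣p∣≤∣q∣ I⊆Z)

  rank-of-indep : ∀ {Z} → Indep Z → HasRank S Z ∣ Z ∣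
  rank-of-indep {Z} indZ = (Z , id , indZ , refl) , λ J J⊆Z _ → p⊆q⇒∣p∣≤∣q∣ J⊆Z

  inCl⇒spans : ∀ {Z e} → InCl S Z e → Spans S Z e
  inCl⇒spans {Z} {e} (_ , k , rankZ , (_ , bounded)) with e ∈? Z
  ... | yes e∈Z = inj₁ e∈Z
  ... | no  e∉Z = inj₂ λ indeZ →
    n≮n ∣ Z ∣ (begin
      suc ∣ Z ∣     ≡⟨ sym (∣⁅x⁆∪p∣ e∉Z) ⟩
      ∣ ⁅ e ⁆ ∪ Z ∣ ≤⟨ bounded (⁅ e ⁆ ∪ Z) (∪-lub (∈∪ʳ Z) (∈∪ˡ ⁅ e ⁆)) indeZ ⟩
      k             ≤⟨ rank≤size rankZ ⟩
      ∣ Z ∣         ∎)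
    where open ≤-Reasoning

  spans⇒inCl : ∀ {Z e} → Indep Z → e ∈ ground → Spans S Z e → InCl S Z e
  spans⇒inCl {Z} {e} indZ e∈E spans =
    e∈E , ∣ Z ∣ , rank-of-indep indZ , ((Z , ∈∪ˡ ⁅ e ⁆ , indZ , refl) , bounded spans)
    where
    bounded : Spans S Z e → ∀ J → J ⊆ Z ∪ ⁅ e ⁆ → Indep J → ∣ J ∣ ≤ ∣ Z ∣
    bounded (inj₁ e∈Z) J J⊆ _ = p⊆q⇒∣p∣≤∣q∣ (λ x∈J → ∪-elim (J⊆ x∈J) id (⁅⁆⊆ e∈Z))
    bounded (inj₂ dep) J J⊆ indJ with ∣ J ∣ ≤? ∣ Z ∣
    ... | yes ∣J∣≤∣Z∣ = ∣J∣≤∣Z∣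
    ... | no  ∣J∣≰∣Z∣ = ⊥-elim (dep (subst Indep J≡ indJ))
      where
      -- J is a subset of Z ∪ {e} of size greater than ∣ Z ∣, hence all of it
      J≡ : J ≡ ⁅ e ⁆ ∪ Z
      J≡ = trans (⊆-antisym J⊆ (⊆-by-card J⊆ (≤-trans (∣p∪⁅x⁆∣≤ Z e) (≰⇒> ∣J∣≰∣Z∣))))
                 (∪-comm Z ⁅ e ⁆)

-- The exchange arguments of matroid theory, phrased with spans.

module SpanTheory {m : ℕ} (M : Matroid m) where
  open Matroid M
  open Closure system

  Span : Subset m → Fin m → Set
  Span = Spans system

  _⊑_ : Subset m → Subset m → Set
  I ⊑ K = ∀ {x} → x ∈ I → Span K x

  span-mono : ∀ {I I′ e} → I ⊆ I′ → Span I e → Span I′ e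
  span-mono I⊆I′ (inj₁ e∈I) = inj₁ (I⊆I′ e∈I)
  span-mono I⊆I′ (inj₂ dep)  = inj₂ λ indeI′ → dep (indep-down indeI′ (∪-mono id I⊆I′))

  basis-spans : ∀ {B} → IsBasis system B → ∀ {e} → e ∈ ground → Span B e
  basis-spans {B} (_ , _ , maximal) {e} e∈E with e ∈? B
  ... | yes e∈B = inj₁ e∈B
  ... | no  e∉B = inj₂ (maximal e e∈E e∉B)

  cl⊆⇒⊑ : ∀ {P Q} → Indep P → P ⊆ ground →
          (∀ e → InCl system P e → InCl system Q e) → P ⊑ Q
  cl⊆⇒⊑ indP P⊆E clP⊆clQ x∈P =
    inCl⇒spans (clP⊆clQ _ (spans⇒inCl indP (P⊆E x∈P) (inj₁ x∈P)))

  extend : ∀ {I T} → Indep I → Indep T → ∣ I ∣ ≤ ∣ T ∣ →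
           ∃ λ K → Indep K × I ⊆ K × K ⊆ I ∪ T × ∣ K ∣ ≡ ∣ T ∣
  extend indI indT ∣I∣≤∣T∣ = grow _ indI indT (proj₂ (m≤n⇒∃[o]m+o≡n ∣I∣≤∣T∣))
    where
    grow : ∀ o {I T} → Indep I → Indep T → ∣ I ∣ + o ≡ ∣ T ∣ →
           ∃ λ K → Indep K × I ⊆ K × K ⊆ I ∪ T × ∣ K ∣ ≡ ∣ T ∣
    grow zero {I} {T} indI _ eq = I , indI , id , ∈∪ˡ T , trans (sym (+-identityʳ _)) eq
    grow (suc o) {I} {T} indI indT eq
      with indep-aug indI indT (<-≤-trans (m<m+n ∣ I ∣ (s≤s z≤n)) (≤-reflexive eq))
    ... | e , e∈T , e∉I , indeI
      with grow o indeI indT (trans (cong (_+ o) (∣⁅x⁆∪p∣ e∉I)) (trans (sym (+-suc ∣ I ∣ o)) eq))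
    ... | K , indK , eI⊆K , K⊆eIT , ∣K∣≡∣T∣ =
      K , indK , (λ x∈I → eI⊆K (∈∪ʳ ⁅ e ⁆ x∈I)) , K⊆IT , ∣K∣≡∣T∣
      where
      K⊆IT : K ⊆ I ∪ T
      K⊆IT x∈K = ∪-elim (K⊆eIT x∈K)
        (λ x∈eI → ∪-elim x∈eI (λ x∈e → ∈∪ʳ I (⁅⁆⊆ e∈T x∈e)) (∈∪ˡ T))
        (∈∪ʳ I)

  span-size : ∀ {I K} → Indep I → Indep K → I ⊑ K → ∣ I ∣ ≤ ∣ K ∣
  span-size {I} {K} indI indK I⊑K with ∣ I ∣ ≤? ∣ K ∣
  ... | yes ∣I∣≤∣K∣ = ∣I∣≤∣K∣
  ... | no  ∣I∣≰∣K∣ with indep-aug indK indI (≰⇒> ∣I∣≰∣K∣)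
  ... | x , x∈I , x∉K , indxK = ⊥-elim (spanned-dependent (I⊑K x∈I) x∉K indxK)

  span-trans : ∀ {I K e} → Indep I → Indep K → I ⊑ K → Span I e → Span K e
  span-trans _ _ I⊑K (inj₁ e∈I) = I⊑K e∈I
  span-trans {I} {K} {e} indI indK I⊑K (inj₂ depI) with e ∈? K
  ... | yes e∈K = inj₁ e∈K
  ... | no  e∉K = inj₂ no-extension
    where
    -- Extend I inside K + e to a set K′ of size ∣ K ∣ + 1.  Then e ∉ K′,
    -- as I + e is dependent; so K′ ⊑ K, which is too large.
    no-extension : ¬ Indep (⁅ e ⁆ ∪ K)
    no-extension indeK
      with extend indI indeK (≤-trans (span-size indI indK I⊑K)
                               (≤-trans (n≤1+n _) (≤-reflexive (sym (∣⁅x⁆∪p∣ e∉K)))))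
    ... | K′ , indK′ , I⊆K′ , K′⊆ , ∣K′∣≡ with e ∈? K′
    ... | yes e∈K′ = depI (indep-down indK′ (∪-lub (⁅⁆⊆ e∈K′) I⊆K′))
    ... | no  e∉K′ = n≮n ∣ K ∣ (≤-trans (≤-reflexive (sym (trans ∣K′∣≡ (∣⁅x⁆∪p∣ e∉K))))
                                        (span-size indK′ indK K′⊑K))
      where
      K′⊑K : K′ ⊑ K
      K′⊑K x∈K′ = ∪-elim (K′⊆ x∈K′) I⊑K λ x∈eK → ∪-elim x∈eK
        (λ x∈e → ⊥-elim (e∉K′ (subst (_∈ K′) (x∈⁅y⁆⇒x≡y e x∈e) x∈K′))) inj₁

  span-swap : ∀ {I J} → Indep I → Indep J → ∣ I ∣ ≤ ∣ J ∣ → J ⊑ I → I ⊑ J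
  span-swap {I} {J} indI indJ ∣I∣≤∣J∣ J⊑I {x} x∈I with x ∈? J
  ... | yes x∈J = inj₁ x∈J
  ... | no  x∉J = inj₂ λ indxJ →
    n≮n ∣ J ∣ (≤-trans (≤-reflexive (sym (∣⁅x⁆∪p∣ x∉J)))
                       (≤-trans (span-size indxJ indI xJ⊑I) ∣I∣≤∣J∣))
    where
    xJ⊑I : (⁅ x ⁆ ∪ J) ⊑ I
    xJ⊑I y∈xJ = ∪-elim y∈xJ (λ y∈x → inj₁ (⁅⁆⊆ x∈I y∈x)) J⊑I

  augment-by : ∀ {S K c} → Indep S → Indep K → ∣ S ∣ < ∣ K ∣ →
               (∀ {x} → x ∈ K → x ≢ c → Span S x) → Indep (⁅ c ⁆ ∪ S)
  augment-by {c = c} indS indK ∣S∣<∣K∣ spanned with indep-aug indS indK ∣S∣<∣K∣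
  ... | x , x∈K , x∉S , indxS with x ≟ c
  ... | yes refl = indxS
  ... | no  x≢c  = ⊥-elim (spanned-dependent (spanned x∈K x≢c) x∉S indxS)

  -- T is an independent set of the size of S lying in the span of S.
  -- For independent S this means that S and T have the same span.
  Balanced : Subset m → Subset m → Set
  Balanced S T = Indep T × T ⊑ S × ∣ S ∣ ≡ ∣ T ∣

  balanced-sym : ∀ {S T} → Indep S → Balanced S T → S ⊑ T
  balanced-sym indS (indT , T⊑S , ∣S∣≡∣T∣) = span-swap indS indT (≤-reflexive ∣S∣≡∣T∣) T⊑S

  balanced-step : ∀ {S T Q a b} → Indep S → Balanced S T →
    Indep (⁅ a ⁆ ∪ S) → a ∉ S → a ∉ T → b ∉ T →
    Indep Q → a ∉ Q → Span Q a → (∀ {y} → y ∈ Q → y ≢ b → Span S y) →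
    Span (⁅ a ⁆ ∪ S) b → Balanced (⁅ a ⁆ ∪ S) (⁅ b ⁆ ∪ T)
  balanced-step {S} {T} {Q} {a} {b} indS bal@(indT , T⊑S , ∣S∣≡∣T∣)
                indaS a∉S a∉T b∉T indQ a∉Q Q-spans-a Q⊑S-but-b aS-spans-b =
    indbT , bT⊑aS , trans (∣⁅x⁆∪p∣ a∉S) (trans (cong suc ∣S∣≡∣T∣) (sym (∣⁅x⁆∪p∣ b∉T)))
    where
    S⊑T : S ⊑ T
    S⊑T = balanced-sym indS bal

    ∣aS∣≡∣aT∣ : ∣ ⁅ a ⁆ ∪ S ∣ ≡ ∣ ⁅ a ⁆ ∪ T ∣
    ∣aS∣≡∣aT∣ = trans (∣⁅x⁆∪p∣ a∉S) (trans (cong suc ∣S∣≡∣T∣) (sym (∣⁅x⁆∪p∣ a∉T)))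

    -- T + a is independent: S + a is larger and spanned by T except for a
    indaT : Indep (⁅ a ⁆ ∪ T)
    indaT = augment-by indT indaS (≤-reflexive (sym (trans ∣aS∣≡∣aT∣ (∣⁅x⁆∪p∣ a∉T))))
      λ x∈aS x≢a → ∪-elim x∈aS (λ x∈a → ⊥-elim (x≢a (x∈⁅y⁆⇒x≡y a x∈a))) S⊑T

    Q⊑aS : Q ⊑ (⁅ a ⁆ ∪ S)
    Q⊑aS {y} y∈Q with y ≟ b
    ... | yes refl = aS-spans-b
    ... | no  y≢b  = span-mono (∈∪ʳ ⁅ a ⁆) (Q⊑S-but-b y∈Q y≢b)

    -- Extend Q inside T + a to a set K of size ∣ T ∣ + 1.  Since Q spans a,
    -- a ∉ K; hence all of K except b is spanned by T.
    indbT : Indep (⁅ b ⁆ ∪ T)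
    indbT with extend indQ indaT (≤-trans (span-size indQ indaS Q⊑aS) (≤-reflexive ∣aS∣≡∣aT∣))
    ... | K , indK , Q⊆K , K⊆QaT , ∣K∣≡ =
      augment-by indT indK (≤-reflexive (sym (trans ∣K∣≡ (∣⁅x⁆∪p∣ a∉T)))) K⊑T-but-b
      where
      a∉K : a ∉ K
      a∉K a∈K = spanned-dependent Q-spans-a a∉Q
                  (indep-down indK (∪-lub (⁅⁆⊆ a∈K) Q⊆K))

      K⊑T-but-b : ∀ {x} → x ∈ K → x ≢ b → Span T x
      K⊑T-but-b x∈K x≢b = ∪-elim (K⊆QaT x∈K)
        (λ x∈Q → span-trans indS indT S⊑T (Q⊑S-but-b x∈Q x≢b))
        (λ x∈aT → ∪-elim x∈aT
          (λ x∈a → ⊥-elim (a∉K (subst (_∈ K) (x∈⁅y⁆⇒x≡y a x∈a) x∈K))) inj₁)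

    bT⊑aS : (⁅ b ⁆ ∪ T) ⊑ (⁅ a ⁆ ∪ S)
    bT⊑aS y∈bT = ∪-elim y∈bT
      (λ y∈b → subst (Span (⁅ a ⁆ ∪ S)) (sym (x∈⁅y⁆⇒x≡y b y∈b)) aS-spans-b)
      (λ y∈T → span-mono (∈∪ʳ ⁅ a ⁆) (T⊑S y∈T))

-- For independent X, independence and spans in M / X \ Y are those of
-- Z ∪ X in M.

module Minor {m : ℕ} (M : Matroid m) (X Y : Subset m) (indX : Matroid.Indep M X) where
  open Matroid M
  open SpanTheory M
  open Closure using (spanned-dependent; inCl⇒spans; spans⇒inCl)

  N : SetSystem m
  N = delete (contract M X) Y

  E′ : Subset m
  E′ = (ground ─ X) ─ Y

  E′⊆E : E′ ⊆ ground
  E′⊆E e∈E′ = p─q⊆p ground X (p─q⊆p (ground ─ X) Y e∈E′)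

  ∈E′⇒∉X : ∀ {e} → e ∈ E′ → e ∉ X
  ∈E′⇒∉X e∈E′ = ∈─⇒∉ (p─q⊆p (ground ─ X) Y e∈E′)

  minor-indep⁺ : ∀ {I} → I ⊆ E′ → Indep (I ∪ X) → SetSystem.Indep N I
  minor-indep⁺ I⊆E′ indIX =
    ((λ x∈I → p─q⊆p (ground ─ X) Y (I⊆E′ x∈I)) ,
     X , id , indX , (λ _ e∈X e∉X _ → e∉X e∈X) , indIX) ,
    I⊆E′

  minor-indep⁻ : ∀ {I} → SetSystem.Indep N I → Indep (I ∪ X)
  minor-indep⁻ {I} ((_ , J , J⊆X , _ , maximal , indIJ) , _) =
    subst (λ Z → Indep (I ∪ Z)) (⊆-antisym J⊆X X⊆J) indIJ
    where
    -- a maximal independent subset of the independent set X is X itself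
    X⊆J : X ⊆ J
    X⊆J {x} x∈X with x ∈? J
    ... | yes x∈J = x∈J
    ... | no  x∉J = ⊥-elim (maximal x x∈X x∉J (indep-down indX (∪-lub (⁅⁆⊆ x∈X) J⊆X)))

  minor-span⁺ : ∀ {Z e} → e ∉ X → Span (Z ∪ X) e → Spans N Z e
  minor-span⁺ e∉X (inj₁ e∈ZX) = inj₁ (∪-elim e∈ZX id (λ e∈X → ⊥-elim (e∉X e∈X)))
  minor-span⁺ {Z} {e} _ (inj₂ dep) = inj₂ λ indN →
    dep (subst Indep (∪-assoc ⁅ e ⁆ Z X) (minor-indep⁻ indN))

  minor-span⁻ : ∀ {Z e} → e ∈ E′ → Z ⊆ E′ → Spans N Z e → Span (Z ∪ X) e
  minor-span⁻ _ _ (inj₁ e∈Z) = inj₁ (∈∪ˡ X e∈Z)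
  minor-span⁻ {Z} {e} e∈E′ Z⊆E′ (inj₂ depN) = inj₂ λ ind →
    depN (minor-indep⁺ (∪-lub (⁅⁆⊆ e∈E′) Z⊆E′) (subst Indep (sym (∪-assoc ⁅ e ⁆ Z X)) ind))

  minor-cl⊆ : ∀ {Z W} → Z ⊆ E′ → W ⊆ E′ → Indep (Z ∪ X) → Indep (W ∪ X) →
              (Z ∪ X) ⊑ (W ∪ X) → ∀ e → InCl N Z e → InCl N W e
  minor-cl⊆ Z⊆E′ W⊆E′ indZX indWX ZX⊑WX e e∈clZ =
    spans⇒inCl N (minor-indep⁺ W⊆E′ indWX) e∈E′
      (minor-span⁺ (∈E′⇒∉X e∈E′)
        (span-trans indZX indWX ZX⊑WX (minor-span⁻ e∈E′ Z⊆E′ (inCl⇒spans N e∈clZ))))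
    where
    e∈E′ = proj₁ e∈clZ

  minor-sameCl : ∀ {Z W} → Z ⊆ E′ → W ⊆ E′ → Indep (Z ∪ X) → Indep (W ∪ X) →
                 (Z ∪ X) ⊑ (W ∪ X) → (W ∪ X) ⊑ (Z ∪ X) → SameCl N Z W
  minor-sameCl Z⊆E′ W⊆E′ indZX indWX ZX⊑WX WX⊑ZX e =
    minor-cl⊆ Z⊆E′ W⊆E′ indZX indWX ZX⊑WX e , minor-cl⊆ W⊆E′ Z⊆E′ indWX indZX WX⊑ZX e

  minor-basis : ∀ {Z} → Z ⊆ E′ → Indep (Z ∪ X) →
                (∀ {e} → e ∈ ground → Span (Z ∪ X) e) → IsBasis N Z
  minor-basis Z⊆E′ indZX ZX-spans =
    Z⊆E′ , minor-indep⁺ Z⊆E′ indZX ,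
    λ e e∈E′ e∉Z → spanned-dependent N (minor-span⁺ (∈E′⇒∉X e∈E′) (ZX-spans (E′⊆E e∈E′))) e∉Z

module _ {m : ℕ} where

  All-toSet : ∀ {P : Fin m → Set} {l x} → All P l → x ∈ toSet l → P x
  All-toSet []             x∈∅ = ⊥-elim (∉⊥ x∈∅)
  All-toSet {P} (px ∷ pl) x∈  = ∪-elim x∈ (λ x∈y → subst P (sym (x∈⁅y⁆⇒x≡y _ x∈y)) px) (All-toSet pl)

  take⊆ : ∀ j (l : List (Fin m)) → toSet (take j l) ⊆ toSet l
  take⊆ zero    l       x∈∅ = ⊥-elim (∉⊥ x∈∅)
  take⊆ (suc j) []      x∈∅ = x∈∅
  take⊆ (suc j) (y ∷ l)     = ∪-mono id (take⊆ j l)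

  toSet-snoc : ∀ (l : List (Fin m)) a → toSet (l ++ a ∷ []) ≡ ⁅ a ⁆ ∪ toSet l
  toSet-snoc []      a = refl
  toSet-snoc (x ∷ l) a = begin
    ⁅ x ⁆ ∪ toSet (l ++ a ∷ [])  ≡⟨ cong (⁅ x ⁆ ∪_) (toSet-snoc l a) ⟩
    ⁅ x ⁆ ∪ (⁅ a ⁆ ∪ toSet l)    ≡⟨ sym (∪-assoc ⁅ x ⁆ ⁅ a ⁆ (toSet l)) ⟩
    (⁅ x ⁆ ∪ ⁅ a ⁆) ∪ toSet l    ≡⟨ cong (_∪ toSet l) (∪-comm ⁅ x ⁆ ⁅ a ⁆) ⟩
    (⁅ a ⁆ ∪ ⁅ x ⁆) ∪ toSet l    ≡⟨ ∪-assoc ⁅ a ⁆ ⁅ x ⁆ (toSet l) ⟩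
    ⁅ a ⁆ ∪ (⁅ x ⁆ ∪ toSet l)    ∎
    where open ≡-Reasoning

  unique-last : ∀ (l : List (Fin m)) {a} → Unique (l ++ a ∷ []) → a ∉ toSet l
  unique-last []      _              a∈∅  = ∉⊥ a∈∅
  unique-last (x ∷ l) {a} (x≢ ∷ uniq) a∈xl = ∪-elim a∈xl
    (λ a∈x → All.lookup x≢ (∈-++⁺ʳ l (here refl)) (sym (x∈⁅y⁆⇒x≡y x a∈x)))
    (unique-last l uniq)

  removeT-∈ : ∀ {a R} (l : List (Fin m)) → a ∈ R → removeT (a ∷ l) R ≡ removeT l R
  removeT-∈ {R = R} _ a∈R = filter-reject (λ z → ¬? (z ∈? R)) (λ a∉R → a∉R a∈R)

  removeT-∉ : ∀ {a R} (l : List (Fin m)) → a ∉ R → removeT (a ∷ l) R ≡ a ∷ removeT l R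
  removeT-∉ {R = R} _ a∉R = filter-accept (λ z → ¬? (z ∈? R)) a∉R

  removed⁻ : ∀ {x R} (l : List (Fin m)) → x ∈ toSet (removeT l R) → x ∈ toSet l × x ∉ R
  removed⁻ []          x∈∅ = ⊥-elim (∉⊥ x∈∅)
  removed⁻ {R = R} (y ∷ l) x∈ with y ∈? R
  ... | yes _   = map₁ (∈∪ʳ ⁅ y ⁆) (removed⁻ l x∈)
  ... | no  y∉R = ∪-elim x∈
    (λ x∈y → ∈∪ˡ (toSet l) x∈y , λ x∈R → y∉R (subst (_∈ R) (x∈⁅y⁆⇒x≡y y x∈y) x∈R))
    (λ x∈rest → map₁ (∈∪ʳ ⁅ y ⁆) (removed⁻ l x∈rest))

  removed⁺ : ∀ {x R} (l : List (Fin m)) → x ∈ toSet l → x ∉ R → x ∈ toSet (removeT l R)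
  removed⁺ []              x∈∅  _   = ⊥-elim (∉⊥ x∈∅)
  removed⁺ {R = R} (y ∷ l) x∈yl x∉R with y ∈? R
  ... | yes y∈R = ∪-elim x∈yl
    (λ x∈y → ⊥-elim (x∉R (subst (_∈ R) (sym (x∈⁅y⁆⇒x≡y y x∈y)) y∈R)))
    (λ x∈l → removed⁺ l x∈l x∉R)
  ... | no  _   = ∪-elim x∈yl (∈∪ˡ _) (λ x∈l → ∈∪ʳ ⁅ y ⁆ (removed⁺ l x∈l x∉R))

  ⊆-removed∪ : ∀ (l : List (Fin m)) R → toSet l ⊆ toSet (removeT l R) ∪ R
  ⊆-removed∪ l R {x} x∈l with x ∈? R
  ... | yes x∈R = ∈∪ʳ _ x∈R
  ... | no  x∉R = ∈∪ˡ R (removed⁺ l x∈l x∉R)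

  removed-snoc-∈ : ∀ (l : List (Fin m)) {a R} → a ∈ R →
                   toSet (removeT (l ++ a ∷ []) R) ≡ toSet (removeT l R)
  removed-snoc-∈ l {a} {R} a∈R = cong toSet (begin
    removeT (l ++ a ∷ []) R            ≡⟨ filter-++ (λ z → ¬? (z ∈? R)) l (a ∷ []) ⟩
    removeT l R ++ removeT (a ∷ []) R  ≡⟨ cong (removeT l R ++_) (removeT-∈ [] a∈R) ⟩
    removeT l R ++ []                  ≡⟨ ++-identityʳ _ ⟩
    removeT l R                        ∎)
    where open ≡-Reasoning

  removed-snoc-∉ : ∀ (l : List (Fin m)) {a R} → a ∉ R →
                   toSet (removeT (l ++ a ∷ []) R) ≡ ⁅ a ⁆ ∪ toSet (removeT l R)
  removed-snoc-∉ l {a} {R} a∉R = begin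
    toSet (removeT (l ++ a ∷ []) R)             ≡⟨ cong toSet (filter-++ (λ z → ¬? (z ∈? R)) l (a ∷ [])) ⟩
    toSet (removeT l R ++ removeT (a ∷ []) R)   ≡⟨ cong (λ r → toSet (removeT l R ++ r)) (removeT-∉ [] a∉R) ⟩
    toSet (removeT l R ++ a ∷ [])               ≡⟨ toSet-snoc (removeT l R) a ⟩
    ⁅ a ⁆ ∪ toSet (removeT l R)                 ∎
    where open ≡-Reasoning

Matched : ∀ {m} → Subset m → Subset m → Fin m → Fin m → Set
Matched X Y a b = (a ∈ X → b ∈ Y) × (b ∈ Y → a ∈ X)

pointwise-take-suc : ∀ {A B : Set} {R : A → B → Set} j {xs ys} → Pointwise R xs ys →
  j < length xs → ∃₂ λ a b → R a b ×
    take (suc j) xs ≡ take j xs ++ a ∷ [] × take (suc j) ys ≡ take j ys ++ b ∷ []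
pointwise-take-suc zero    (r ∷ _) _ = _ , _ , r , refl , refl
pointwise-take-suc (suc j) (_∷_ {x} {y} _ rs) (s≤s j<) with pointwise-take-suc j rs j<
... | a , b , r , eqx , eqy = a , b , r , cong (x ∷_) eqx , cong (y ∷_) eqy

module _ {m : ℕ} where

  module _ {X Y : Subset m} where

    length-removeT : ∀ {as bs} → Pointwise (Matched X Y) as bs →
                     length (removeT as X) ≡ length (removeT bs Y)
    length-removeT [] = refl
    length-removeT {a ∷ as} {b ∷ bs} ((a→b , b→a) ∷ ms) with a ∈? X
    ... | yes a∈X = trans (length-removeT ms) (cong length (sym (removeT-∈ bs (a→b a∈X))))
    ... | no  a∉X = trans (cong suc (length-removeT ms))
                          (cong length (sym (removeT-∉ bs (λ b∈Y → a∉X (b→a b∈Y)))))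

    prefix-of-removal : ∀ {as bs} → Pointwise (Matched X Y) as bs →
      ∀ k → k ≤ length (removeT as X) → ∃ λ j → j ≤ length as ×
        take k (removeT as X) ≡ removeT (take j as) X ×
        take k (removeT bs Y) ≡ removeT (take j bs) Y
    prefix-of-removal [] zero _ = zero , z≤n , refl , refl
    prefix-of-removal {a ∷ as} {b ∷ bs} ((a→b , b→a) ∷ ms) k k≤ with a ∈? X
    ... | yes a∈X with prefix-of-removal ms k k≤
    ...   | j , j≤ , eqA , eqB =
      suc j , s≤s j≤ , trans eqA (sym (removeT-∈ (take j as) a∈X)) ,
      trans (cong (take k) (removeT-∈ bs b∈Y)) (trans eqB (sym (removeT-∈ (take j bs) b∈Y)))
      where b∈Y = a→b a∈X
    prefix-of-removal _ zero _ | no _ = zero , z≤n , refl , refl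
    prefix-of-removal {a ∷ as} {b ∷ bs} ((_ , b→a) ∷ ms) (suc k) (s≤s k≤) | no a∉X
      with prefix-of-removal ms k k≤
    ... | j , j≤ , eqA , eqB =
      suc j , s≤s j≤ , trans (cong (a ∷_) eqA) (sym (removeT-∉ (take j as) a∉X)) ,
      trans (cong (take (suc k)) (removeT-∉ bs b∉Y))
            (trans (cong (b ∷_) eqB) (sym (removeT-∉ (take j bs) b∉Y)))
      where b∉Y = λ b∈Y → a∉X (b→a b∈Y)

  φImage⊆ : ∀ {X : Subset m} as bs → φImage as bs X ⊆ toSet bs
  φImage⊆ []       _        x∈∅ = ⊥-elim (∉⊥ x∈∅)
  φImage⊆ (_ ∷ _)  []       x∈∅ = ⊥-elim (∉⊥ x∈∅)
  φImage⊆ {X} (a ∷ as) (b ∷ bs) with a ∈? X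
  ... | yes _ = ∪-mono id (φImage⊆ as bs)
  ... | no  _ = λ x∈φ → ∈∪ʳ ⁅ b ⁆ (φImage⊆ as bs x∈φ)

  matched-extend : ∀ {X Y : Subset m} {b as bs} → All (b ≢_) bs →
                   Pointwise (Matched X Y) as bs → Pointwise (Matched X (⁅ b ⁆ ∪ Y)) as bs
  matched-extend [] [] = []
  matched-extend {b = b} (b≢b′ ∷ b∉bs) ((a→b′ , b′→a) ∷ ms) =
    ((λ a∈X → ∈∪ʳ ⁅ b ⁆ (a→b′ a∈X)) ,
     (λ b′∈ → b′→a (∪-elim b′∈ (λ b′∈b → ⊥-elim (b≢b′ (sym (x∈⁅y⁆⇒x≡y b b′∈b)))) id))) ∷
    matched-extend b∉bs ms

  φImage-matched : ∀ {X : Subset m} as bs → length as ≡ length bs → Unique bs →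
                   Pointwise (Matched X (φImage as bs X)) as bs
  φImage-matched []       []       _  _ = []
  φImage-matched {X} (a ∷ as) (b ∷ bs) eq (b∉bs ∷ uniq) with a ∈? X
  ... | yes a∈X = ((λ _ → ∈∪ˡ _ (x∈⁅x⁆ b)) , (λ _ → a∈X)) ∷
                  matched-extend b∉bs (φImage-matched as bs (suc-injective eq) uniq)
  ... | no  a∉X = ((λ a∈X → ⊥-elim (a∉X a∈X)) , (λ b∈φ → ⊥-elim (b∉ b∈φ))) ∷
                  φImage-matched as bs (suc-injective eq) uniq
    where
    b∉ : b ∉ φImage as bs X
    b∉ b∈φ = All-toSet b∉bs (φImage⊆ as bs b∈φ) refl

upper-triangular-swap : ∀ {m} {S : SetSystem m} {as bs} →
                        UpperTriangular S as bs → UpperTriangular S bs as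
upper-triangular-swap (len , uA , uB , disj , cover , basisA , basisB , prefixes) =
  sym len , uB , uA , trans (∩-comm _ _) disj , trans (∪-comm _ _) cover , basisB , basisA ,
  λ k 1≤k k≤ e → swap (prefixes k 1≤k (subst (k ≤_) (sym len) k≤) e)

module MinorOfUpperTriangular
  {m : ℕ} (M : Matroid m) {as bs : List (Fin m)} {X Y : Subset m}
  (matched  : Pointwise (Matched X Y) as bs)
  (uniqueA  : Unique as) (uniqueB : Unique bs)
  (disjoint : toSet as ∩ toSet bs ≡ ∅)
  (cover    : toSet as ∪ toSet bs ≡ Matroid.ground M)
  (basisA   : IsBasis (Matroid.system M) (toSet as))
  (basisB   : IsBasis (Matroid.system M) (toSet bs))
  (prefixes : ∀ k → 1 ≤ k → k ≤ length as →
              SameCl (Matroid.system M) (toSet (take k as)) (toSet (take k bs)))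
  (X⊆A : X ⊆ toSet as) (Y⊆B : Y ⊆ toSet bs)
  where

  open Matroid M
  open SpanTheory M

  n : ℕ
  n = length as

  A B : Subset m
  A = toSet as
  B = toSet bs

  A∌B : ∀ {x} → x ∈ A → x ∉ B
  A∌B x∈A x∈B = ∉⊥ (subst (_ ∈_) disjoint (x∈p∩q⁺ (x∈A , x∈B)))

  indA : Indep A
  indA = proj₁ (proj₂ basisA)

  indB : Indep B
  indB = proj₁ (proj₂ basisB)

  open Minor M X Y (indep-down indA X⊆A)

  RA RB SA SB : ℕ → Subset m
  RA j = toSet (removeT (take j as) X)
  RB j = toSet (removeT (take j bs) Y)
  SA j = RA j ∪ X
  SB j = RB j ∪ X

  SA⊆A : ∀ j → SA j ⊆ A
  SA⊆A j = ∪-lub (λ x∈RA → take⊆ j as (proj₁ (removed⁻ (take j as) x∈RA))) X⊆A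

  indSA : ∀ j → Indep (SA j)
  indSA j = indep-down indA (SA⊆A j)

  A-part⊆E′ : ∀ l → toSet l ⊆ A → toSet (removeT l X) ⊆ E′
  A-part⊆E′ l l⊆A x∈ = let x∈l , x∉X = removed⁻ l x∈ in
    x∈p∧x∉q⇒x∈p─q (x∈p∧x∉q⇒x∈p─q (proj₁ basisA (l⊆A x∈l)) x∉X)
                  (λ x∈Y → A∌B (l⊆A x∈l) (Y⊆B x∈Y))

  B-part⊆E′ : ∀ l → toSet l ⊆ B → toSet (removeT l Y) ⊆ E′
  B-part⊆E′ l l⊆B x∈ = let x∈l , x∉Y = removed⁻ l x∈ in
    x∈p∧x∉q⇒x∈p─q (x∈p∧x∉q⇒x∈p─q (proj₁ basisB (l⊆B x∈l)) (λ x∈X → A∌B (X⊆A x∈X) (l⊆B x∈l)))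
                  x∉Y

  prefix-spans : ∀ j → j ≤ n → toSet (take j bs) ⊑ toSet (take j as) ×
                               toSet (take j as) ⊑ toSet (take j bs)
  prefix-spans zero    _   = (λ x∈∅ → ⊥-elim (∉⊥ x∈∅)) , (λ x∈∅ → ⊥-elim (∉⊥ x∈∅))
  prefix-spans (suc j) j<n =
    cl⊆⇒⊑ (indep-down indB (take⊆ (suc j) bs)) (λ x∈ → proj₁ basisB (take⊆ (suc j) bs x∈))
          (λ e → proj₂ (same e)) ,
    cl⊆⇒⊑ (indep-down indA (take⊆ (suc j) as)) (λ x∈ → proj₁ basisA (take⊆ (suc j) as x∈))
          (λ e → proj₁ (same e))
    where
    same : SameCl system (toSet (take (suc j) as)) (toSet (take (suc j) bs))
    same = prefixes (suc j) (s≤s z≤n) j<n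

  kept-skip : ∀ (l : List (Fin m)) j {R c} → take (suc j) l ≡ take j l ++ c ∷ [] → c ∈ R →
              toSet (removeT (take (suc j) l) R) ∪ X ≡ toSet (removeT (take j l) R) ∪ X
  kept-skip l j eq c∈R =
    cong (_∪ X) (trans (cong (λ r → toSet (removeT r _)) eq) (removed-snoc-∈ (take j l) c∈R))

  kept-grow : ∀ (l : List (Fin m)) j {R c} → take (suc j) l ≡ take j l ++ c ∷ [] → c ∉ R →
              toSet (removeT (take (suc j) l) R) ∪ X ≡ ⁅ c ⁆ ∪ (toSet (removeT (take j l) R) ∪ X)
  kept-grow l j {c = c} eq c∉R =
    trans (cong (_∪ X) (trans (cong (λ r → toSet (removeT r _)) eq) (removed-snoc-∉ (take j l) c∉R)))
          (∪-assoc ⁅ c ⁆ _ X)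

  prefix-snoc : ∀ (l : List (Fin m)) j {c} → take (suc j) l ≡ take j l ++ c ∷ [] →
                toSet (take (suc j) l) ≡ ⁅ c ⁆ ∪ toSet (take j l)
  prefix-snoc l j {c} eq = trans (cong toSet eq) (toSet-snoc (take j l) c)

  grow-step : ∀ j {a b} → suc j ≤ n →
              take (suc j) as ≡ take j as ++ a ∷ [] → take (suc j) bs ≡ take j bs ++ b ∷ [] →
              a ∉ X → b ∉ Y → Balanced (SA j) (SB j) → Balanced (⁅ a ⁆ ∪ SA j) (⁅ b ⁆ ∪ SB j)
  grow-step j {a} {b} j<n takeA takeB a∉X b∉Y bal =
    balanced-step (indSA j) bal (indep-down indA (∪-lub (⁅⁆⊆ a∈A) (SA⊆A j))) a∉SA a∉SB b∉SB
      (indep-down indB (take⊆ (suc j) bs)) (λ a∈B′ → A∌B a∈A (take⊆ (suc j) bs a∈B′))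
      (proj₂ (prefix-spans (suc j) j<n) a∈A′) B′⊑SA-but-b
      (span-mono A′⊆aSA (proj₁ (prefix-spans (suc j) j<n) b∈B′))
    where
    a∈A′ : a ∈ toSet (take (suc j) as)
    a∈A′ = subst (a ∈_) (sym (prefix-snoc as j takeA)) (∈∪ˡ (toSet (take j as)) (x∈⁅x⁆ a))
    b∈B′ : b ∈ toSet (take (suc j) bs)
    b∈B′ = subst (b ∈_) (sym (prefix-snoc bs j takeB)) (∈∪ˡ (toSet (take j bs)) (x∈⁅x⁆ b))
    a∈A : a ∈ A
    a∈A = take⊆ (suc j) as a∈A′
    b∈B : b ∈ B
    b∈B = take⊆ (suc j) bs b∈B′

    -- the new entries are new, as the tuples are duplicate-free
    a∉Aⱼ : a ∉ toSet (take j as)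
    a∉Aⱼ = unique-last (take j as) (subst Unique takeA (take⁺ (suc j) uniqueA))
    b∉Bⱼ : b ∉ toSet (take j bs)
    b∉Bⱼ = unique-last (take j bs) (subst Unique takeB (take⁺ (suc j) uniqueB))

    a∉SA : a ∉ SA j
    a∉SA a∈ = ∪-elim a∈ (λ a∈RA → a∉Aⱼ (proj₁ (removed⁻ (take j as) a∈RA))) a∉X
    a∉SB : a ∉ SB j
    a∉SB a∈ = ∪-elim a∈ (λ a∈RB → A∌B a∈A (take⊆ j bs (proj₁ (removed⁻ (take j bs) a∈RB)))) a∉X
    b∉SB : b ∉ SB j
    b∉SB b∈ = ∪-elim b∈ (λ b∈RB → b∉Bⱼ (proj₁ (removed⁻ (take j bs) b∈RB)))
                         (λ b∈X → A∌B (X⊆A b∈X) b∈B)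

    A′⊆aSA : toSet (take (suc j) as) ⊆ ⁅ a ⁆ ∪ SA j
    A′⊆aSA x∈ = ∪-mono id (⊆-removed∪ (take j as) X) (subst (_ ∈_) (prefix-snoc as j takeA) x∈)

    B′⊑SA-but-b : ∀ {y} → y ∈ toSet (take (suc j) bs) → y ≢ b → Span (SA j) y
    B′⊑SA-but-b y∈B′ y≢b = ∪-elim (subst (_ ∈_) (prefix-snoc bs j takeB) y∈B′)
      (λ y∈b → ⊥-elim (y≢b (x∈⁅y⁆⇒x≡y b y∈b)))
      (λ y∈Bⱼ → span-mono (⊆-removed∪ (take j as) X) (proj₁ (prefix-spans j (<⇒≤ j<n)) y∈Bⱼ))

  balanced : ∀ j → j ≤ n → Balanced (SA j) (SB j)
  balanced zero    _   = indSA zero , inj₁ , refl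
  balanced (suc j) j<n with pointwise-take-suc j matched j<n
  ... | a , b , (a→b , b→a) , takeA , takeB with a ∈? X
  ... | yes a∈X = subst₂ Balanced (sym (kept-skip as j takeA a∈X)) (sym (kept-skip bs j takeB (a→b a∈X)))
                    (balanced j (<⇒≤ j<n))
  ... | no  a∉X = subst₂ Balanced (sym (kept-grow as j takeA a∉X)) (sym (kept-grow bs j takeB b∉Y))
                    (grow-step j j<n takeA takeB a∉X b∉Y (balanced j (<⇒≤ j<n)))
    where
    b∉Y : b ∉ Y
    b∉Y b∈Y = a∉X (b→a b∈Y)

  balanced-full : Balanced (toSet (removeT as X) ∪ X) (toSet (removeT bs Y) ∪ X)
  balanced-full = subst₂ Balanced (cong (λ l → toSet (removeT l X) ∪ X) (take-all n as ≤-refl))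
                                  (cong (λ l → toSet (removeT l Y) ∪ X) (take-all n bs n≥∣bs∣))
                                  (balanced n ≤-refl)
    where
    n≥∣bs∣ : length bs ≤ n
    n≥∣bs∣ = ≤-reflexive (sym (Pointwise-length matched))

  indAX : Indep (toSet (removeT as X) ∪ X)
  indAX = indep-down indA (∪-lub (λ x∈ → proj₁ (removed⁻ as x∈)) X⊆A)

  AX-spans : ∀ {e} → e ∈ ground → Span (toSet (removeT as X) ∪ X) e
  AX-spans e∈E = span-mono (⊆-removed∪ as X) (basis-spans basisA e∈E)

  BY-spans : ∀ {e} → e ∈ ground → Span (toSet (removeT bs Y) ∪ X) e
  BY-spans e∈E = span-trans indAX (proj₁ balanced-full)
                   (balanced-sym indAX balanced-full) (AX-spans e∈E)

  disjoint′ : toSet (removeT as X) ∩ toSet (removeT bs Y) ≡ ∅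
  disjoint′ = ⊆-antisym (λ x∈∩ → let x∈RA , x∈RB = x∈p∩q⁻ _ _ x∈∩ in
                          ⊥-elim (A∌B (proj₁ (removed⁻ as x∈RA)) (proj₁ (removed⁻ bs x∈RB))))
                        ⊥⊆

  cover′ : toSet (removeT as X) ∪ toSet (removeT bs Y) ≡ E′
  cover′ = ⊆-antisym (∪-lub (A-part⊆E′ as id) (B-part⊆E′ bs id)) E′⊆parts
    where
    E′⊆parts : E′ ⊆ toSet (removeT as X) ∪ toSet (removeT bs Y)
    E′⊆parts {x} x∈E′ = ∪-elim (subst (x ∈_) (sym cover) (E′⊆E x∈E′))
      (λ x∈A → ∈∪ˡ _ (removed⁺ as x∈A (∈E′⇒∉X x∈E′)))
      (λ x∈B → ∈∪ʳ _ (removed⁺ bs x∈B (∈─⇒∉ x∈E′)))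

  prefixes′ : ∀ k → 1 ≤ k → k ≤ length (removeT as X) →
              SameCl N (toSet (take k (removeT as X))) (toSet (take k (removeT bs Y)))
  prefixes′ k _ k≤ with prefix-of-removal matched k k≤
  ... | j , j≤n , eqA , eqB =
    subst₂ (SameCl N) (cong toSet (sym eqA)) (cong toSet (sym eqB))
      (minor-sameCl (A-part⊆E′ (take j as) (take⊆ j as)) (B-part⊆E′ (take j bs) (take⊆ j bs))
                    (indSA j) indSB (balanced-sym (indSA j) bal) SB⊑SA)
    where
    bal : Balanced (SA j) (SB j)
    bal = balanced j j≤n
    indSB : Indep (SB j)
    indSB = proj₁ bal
    SB⊑SA : SB j ⊑ SA j
    SB⊑SA = proj₁ (proj₂ bal)

  upper-triangular : UpperTriangular N (removeT as X) (removeT bs Y)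
  upper-triangular =
    length-removeT matched , filter⁺ _ uniqueA , filter⁺ _ uniqueB , disjoint′ , cover′ ,
    minor-basis (A-part⊆E′ as id) indAX AX-spans ,
    minor-basis (B-part⊆E′ bs id) (proj₁ balanced-full) BY-spans ,
    prefixes′

minor-upper-triangular : ∀ {m} (M : Matroid m) {as bs} {X Y : Subset m} →
  UpperTriangular (Matroid.system M) as bs → X ⊆ toSet as → Y ⊆ toSet bs →
  Pointwise (Matched X Y) as bs →
  UpperTriangular (delete (contract M X) Y) (removeT as X) (removeT bs Y)
minor-upper-triangular M (_ , uA , uB , disj , cover , basisA , basisB , prefixes) X⊆A Y⊆B matched =
  MinorOfUpperTriangular.upper-triangular M matched uA uB disj cover basisA basisB prefixes X⊆A Y⊆B

lemma3p2 : {m : ℕ} (M : Matroid m) (as bs : List (Fin m)) →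
    UpperTriangular (Matroid.system M) as bs →
    (X : Subset m) → X ⊆ toSet as →
    UpperTriangular (delete (contract M X) (φImage as bs X))
    (removeT as X) (removeT bs (φImage as bs X))
    ×
    UpperTriangular (delete (contract M (φImage as bs X)) X)
    (removeT as X) (removeT bs (φImage as bs X))
lemma3p2 M as bs ut@(len , _ , uniqueB , _) X X⊆A =
    minor-upper-triangular M ut X⊆A Y⊆B matched
  , upper-triangular-swap
      (minor-upper-triangular M (upper-triangular-swap ut) Y⊆B X⊆A (symmetric swap matched))
  where
  Y⊆B : φImage as bs X ⊆ toSet bs
  Y⊆B = φImage⊆ as bs
  matched : Pointwise (Matched X (φImage as bs X)) as bs
  matched = φImage-matched as bs len uniqueB
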